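{- Let $P$ be a finite poset with elements labeled $v_1,\ldots,v_n$, and suppose an element $v\in P$ covers elements $u_1,\ldots,u_k\in P$ with $k\ge2$. Let $F=\{\{u_i,v\}\mid i\in[k]\}$. Then \[Y_{\mathrm{inc}(P)}=\sum_{\substack{S\subseteq F\\ S\neq\emptyset}}(-1)^{|S|-1}Y_{\mathrm{inc}(P)\cup S},\qquad X_{\mathrm{inc}(P)}=\sum_{\substack{S\subseteq F\\ S\neq\emptyset}}(-1)^{|S|-1}X_{\mathrm{inc}(P)\cup S}.\] The same expansions hold if instead $v$ is covered by $u_1,\ldots,u_k$ ($k\ge 2$).
   Context: $\mathrm{inc}(P)$ is the graph on $P$ (with the same vertex labels) whose edges are pairs of incomparable elements; $\mathrm{inc}(P)\cup S$ is obtained by adding the edges in $S$. For a graph $G$ with vertices labeled $v_1,\ldots,v_n$, $Y_G=\sum_k x_{k(v_1)}\cdots x_{k(v_n)}$ in noncommuting variables and $X_G$ the same sum in commuting variables, summed over all proper colorings $k:V\to\mathbb{N}$. "$v$ covers $u$" means $u<_Pv$ and there is no $w$ with $u<_Pw<_Pv$. -}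

module Defs where

open import Data.Nat as ℕ using (ℕ; zero; suc; _≡ᵇ_; _⊔_; _∸_)
open import Data.Fin as Fin using (Fin; toℕ)
open import Data.Bool using (Bool; true; false; not; _∧_; _∨_; if_then_else_)
open import Data.List using (List; []; _∷_; [_]; map; concatMap; foldr; allFin; upTo)
open import Data.Bool.ListAction using (all; any)
open import Data.Nat.ListAction using (sum)
open import Data.Vec using (Vec; lookup) renaming ([] to []ᵥ; _∷_ to _∷ᵥ_)
open import Data.Vec.Functional as VF using ()
open import Data.Integer as ℤ using (ℤ; +_; -_; _*_; _+_)
open import Data.Product using (_×_)
open import Data.Sum using (_⊎_)
open import Relation.Nullary using (¬_)
open import Relation.Nullary.Decidable using (⌊_⌋)
open import Relation.Binary.PropositionalEquality using (_≡_)
open import Relation.Binary.Structures using (IsDecPartialOrder)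

Graph : ℕ → Set
Graph n = Fin n → Fin n → Bool

_==_ : ∀ {n} → Fin n → Fin n → Bool
a == b = ⌊ a Fin.≟ b ⌋

isProper : ∀ {n} → Graph n → (Fin n → ℕ) → Bool
isProper {n} G k =
  all (λ a → all (λ b → not (G a b) ∨ not (k a ≡ᵇ k b)) (allFin n)) (allFin n)

-- Y_G in noncommuting variables, represented by its coefficients:
-- the monomial x_{k(v_1)} ⋯ x_{k(v_n)} (a word, determined by k) has
-- coefficient 1 if k is proper and 0 otherwise.

Y : ∀ {n} → Graph n → (Fin n → ℕ) → ℤ
Y G k = if isProper G k then + 1 else + 0

-- X_G in commuting variables, represented by its coefficients: the
-- coefficient of the commutative monomial x_{w(v_1)} ⋯ x_{w(v_n)} is the
-- number of proper colourings k with the same content as w (i.e. each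
-- colour j used equally often by k and w).  All such k take values
-- ≤ max w, so enumerating colourings Fin n → Fin (suc (max w)) is exhaustive.

allFuns : ∀ n m → List (Fin n → Fin m)
allFuns zero    m = [ (λ ()) ]
allFuns (suc n) m =
  concatMap (λ f → map (λ j → j VF.∷ f) (allFin m)) (allFuns n m)

mult : ∀ {n} → (Fin n → ℕ) → ℕ → ℕ
mult {n} k j = sum (map (λ i → if k i ≡ᵇ j then 1 else 0) (allFin n))

maxCol : ∀ {n} → (Fin n → ℕ) → ℕ
maxCol {n} w = foldr _⊔_ 0 (map w (allFin n))

sameContent : ∀ {n} → (Fin n → ℕ) → (Fin n → ℕ) → Bool
sameContent w k = all (λ j → mult w j ≡ᵇ mult k j) (upTo (suc (maxCol w)))

X : ∀ {n} → Graph n → (Fin n → ℕ) → ℤ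
X {n} G w =
  + sum (map (λ f → if sameContent w (λ i → toℕ (f i)) ∧ isProper G (λ i → toℕ (f i))
                    then 1 else 0)
             (allFuns n (suc (maxCol w))))

module _ {n : ℕ} {_≼_ : Fin n → Fin n → Set} where

  inc : IsDecPartialOrder _≡_ _≼_ → Graph n
  inc po a b = not ⌊ a ≤? b ⌋ ∧ not ⌊ b ≤? a ⌋
    where open IsDecPartialOrder po using (_≤?_)

Covers : ∀ {n} → (Fin n → Fin n → Set) → Fin n → Fin n → Set
Covers _≼_ x y = (x ≼ y) × (¬ x ≡ y) × (∀ z → x ≼ z → z ≼ y → (z ≡ x) ⊎ (z ≡ y))

-- Subsets S of F = {{u_i , v} | i ∈ [k]}, encoded as Vec Bool k.

allSubsets : ∀ k → List (Vec Bool k)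
allSubsets zero    = [ []ᵥ ]
allSubsets (suc k) = concatMap (λ s → (true ∷ᵥ s) ∷ (false ∷ᵥ s) ∷ []) (allSubsets k)

card : ∀ {k} → Vec Bool k → ℕ
card []ᵥ           = 0
card (true ∷ᵥ s)  = suc (card s)
card (false ∷ᵥ s) = card s

sgn : ℕ → ℤ
sgn zero    = + 1
sgn (suc m) = - sgn m

addEdges : ∀ {n k} → Graph n → (Fin k → Fin n) → Fin n → Vec Bool k → Graph n
addEdges {n} {k} G u v S a b =
  G a b ∨ any (λ i → lookup S i ∧ ((a == u i ∧ b == v) ∨ (a == v ∧ b == u i))) (allFin k)

altSum : ∀ {k} → (Vec Bool k → ℤ) → ℤ
altSum {k} f =
  foldr _+_ (+ 0)
    (map (λ S → if card S ≡ᵇ 0 then + 0 else sgn (card S ∸ 1) * f S) (allSubsets k))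

-- Adding the edge {u_i, v} only forbids the colourings with c(u_i) = c(v), so the
-- coefficient of a colouring c in Y_{inc(P) ∪ S} is [c proper for inc(P)] · [S avoids D],
-- where D = {i | c(u_i) = c(v)}.  By inclusion–exclusion, Σ_{S ≠ ∅} (-1)^{|S|-1} [S avoids D]
-- is 1 unless D = [k]; toggling a coordinate i ∉ D is a sign-reversing involution on the
-- subsets avoiding D.  Two distinct elements covered by (or covering) the same v are
-- incomparable, hence adjacent in inc(P), so a proper colouring cannot give u_1 and u_2
-- both the colour of v, and D ≠ [k].  X_G is obtained from Y_G by a linear map, which
-- transports the identity.
module Submission where

open import Defs
open import Data.Bool using (Bool; true; false; not; _∧_; _∨_; if_then_else_; T)
open import Data.Bool.ListAction using (all; any)
open import Data.Bool.Properties using (T-∧; T-∨; T-≡; T-not-≡; ⇔→≡)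
open import Data.Fin as Fin using (Fin; zero; suc; toℕ)
open import Data.Fin.Properties using (0≢1+n)
open import Data.Integer using (ℤ; +_; -_; _+_; _-_; _*_)
import Data.Integer.Properties as ℤ
open import Data.Integer.Solver using (module +-*-Solver)
open import Data.List using (List; []; _∷_; map; foldr; concatMap; allFin)
import Data.List.Relation.Unary.All.Properties as All
import Data.List.Relation.Unary.Any.Properties as Any
open import Data.Nat as ℕ using (ℕ; _≤_; _≡ᵇ_; s≤s; z≤n)
import Data.Nat.Properties as ℕ
open import Data.Nat.ListAction using (sum)
open import Data.Product as Product using (_×_; _,_; ∃-syntax)
open import Data.Sum using (_⊎_; inj₁; inj₂)
open import Data.Vec as Vec using (Vec; lookup; replicate; _[_]≔_)
open import Function using (_∘_; _⇔_; mk⇔; Equivalence)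
import Function.Properties.Equivalence as ⇔
open import Function.Definitions using (Injective)
open import Relation.Binary.PropositionalEquality
open import Relation.Binary.Structures using (IsDecPartialOrder)
open import Relation.Nullary using (¬_; yes; no)
open import Relation.Nullary.Decidable using (⌊_⌋; toWitness; fromWitness; fromWitnessFalse)

open Equivalence using (to; from)
open ≡-Reasoning

∑ : ∀ {A : Set} → List A → (A → ℤ) → ℤ
∑ xs f = foldr _+_ (+ 0) (map f xs)

module _ {A : Set} where

  ∑-cong : (xs : List A) {f g : A → ℤ} → (∀ x → f x ≡ g x) → ∑ xs f ≡ ∑ xs g
  ∑-cong []       f≗g = refl
  ∑-cong (x ∷ xs) f≗g = cong₂ _+_ (f≗g x) (∑-cong xs f≗g)

  ∑-+ : (xs : List A) (f g : A → ℤ) → ∑ xs (λ x → f x + g x) ≡ ∑ xs f + ∑ xs g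
  ∑-+ []       f g = refl
  ∑-+ (x ∷ xs) f g = begin
    (f x + g x) + ∑ xs (λ y → f y + g y) ≡⟨ cong (_+_ (f x + g x)) (∑-+ xs f g) ⟩
    (f x + g x) + (∑ xs f + ∑ xs g)     ≡⟨ interchange (f x) (g x) (∑ xs f) (∑ xs g) ⟩
    (f x + ∑ xs f) + (g x + ∑ xs g)     ∎
    where
    open +-*-Solver
    interchange : ∀ a b c d → (a + b) + (c + d) ≡ (a + c) + (b + d)
    interchange = solve 4 (λ a b c d → (a :+ b) :+ (c :+ d) := (a :+ c) :+ (b :+ d)) refl

  ∑-neg : (xs : List A) (f : A → ℤ) → ∑ xs (λ x → - f x) ≡ - ∑ xs f
  ∑-neg []       f = refl
  ∑-neg (x ∷ xs) f =
    trans (cong (_+_ (- f x)) (∑-neg xs f)) (sym (ℤ.neg-distrib-+ (f x) (∑ xs f)))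

  ∑-*ˡ : (xs : List A) (a : ℤ) (f : A → ℤ) → ∑ xs (λ x → a * f x) ≡ a * ∑ xs f
  ∑-*ˡ []       a f = sym (ℤ.*-zeroʳ a)
  ∑-*ˡ (x ∷ xs) a f =
    trans (cong (_+_ (a * f x)) (∑-*ˡ xs a f)) (sym (ℤ.*-distribˡ-+ a (f x) (∑ xs f)))

  ∑-pairs : ∀ {B : Set} (g h : A → B) (xs : List A) (f : B → ℤ) →
            ∑ (concatMap (λ x → g x ∷ h x ∷ []) xs) f ≡ ∑ xs (λ x → f (g x) + f (h x))
  ∑-pairs g h []       f = refl
  ∑-pairs g h (x ∷ xs) f =
    trans (cong (λ t → f (g x) + (f (h x) + t)) (∑-pairs g h xs f))
          (sym (ℤ.+-assoc (f (g x)) (f (h x)) _))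

  +sum≡∑ : (xs : List A) (h : A → ℕ) → + sum (map h xs) ≡ ∑ xs (λ x → + h x)
  +sum≡∑ []       h = refl
  +sum≡∑ (x ∷ xs) h = cong (_+_ (+ h x)) (+sum≡∑ xs h)

∑-comm : ∀ {A B : Set} (xs : List A) (ys : List B) (f : A → B → ℤ) →
         ∑ xs (λ x → ∑ ys (f x)) ≡ ∑ ys (λ y → ∑ xs (λ x → f x y))
∑-comm []       ys f = sym (∑-*ˡ ys (+ 0) (λ _ → + 0))
∑-comm (x ∷ xs) ys f =
  trans (cong (_+_ (∑ ys (f x))) (∑-comm xs ys f)) (sym (∑-+ ys (f x) _))

signedSum : ∀ {k} → (Vec Bool k → ℤ) → ℤ
signedSum {k} f = ∑ (allSubsets k) (λ S → sgn (card S) * f S)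

altSign : ∀ {k} → Vec Bool k → ℤ
altSign S = if card S ≡ᵇ 0 then + 0 else sgn (card S ℕ.∸ 1)

module _ {k : ℕ} where

  altSum≡∑ : (f : Vec Bool k → ℤ) → altSum f ≡ ∑ (allSubsets k) (λ S → altSign S * f S)
  altSum≡∑ f = ∑-cong (allSubsets k) (λ S → if-* (card S ≡ᵇ 0) (sgn (card S ℕ.∸ 1)) (f S))
    where
    if-* : ∀ b s x → (if b then + 0 else s * x) ≡ (if b then + 0 else s) * x
    if-* true  s x = refl
    if-* false s x = refl

  altSum-cong : {f g : Vec Bool k → ℤ} → (∀ S → f S ≡ g S) → altSum f ≡ altSum g
  altSum-cong {f} {g} f≗g = begin
    altSum f                                 ≡⟨ altSum≡∑ f ⟩
    ∑ (allSubsets k) (λ S → altSign S * f S) ≡⟨ ∑-cong (allSubsets k) (λ S → cong (altSign S *_) (f≗g S)) ⟩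
    ∑ (allSubsets k) (λ S → altSign S * g S) ≡⟨ altSum≡∑ g ⟨
    altSum g                                 ∎

  altSum-*ˡ : (a : ℤ) (f : Vec Bool k → ℤ) → altSum (λ S → a * f S) ≡ a * altSum f
  altSum-*ˡ a f = begin
    altSum (λ S → a * f S)                         ≡⟨ altSum≡∑ _ ⟩
    ∑ (allSubsets k) (λ S → altSign S * (a * f S)) ≡⟨ ∑-cong (allSubsets k) (λ S → swap (altSign S) a (f S)) ⟩
    ∑ (allSubsets k) (λ S → a * (altSign S * f S)) ≡⟨ ∑-*ˡ (allSubsets k) a _ ⟩
    a * ∑ (allSubsets k) (λ S → altSign S * f S)   ≡⟨ cong (a *_) (altSum≡∑ f) ⟨
    a * altSum f                                   ∎
    where
    open +-*-Solver
    swap : ∀ x y z → x * (y * z) ≡ y * (x * z)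
    swap = solve 3 (λ x y z → x :* (y :* z) := y :* (x :* z)) refl

  altSum-∑ : ∀ {A : Set} (xs : List A) (f : Vec Bool k → A → ℤ) →
             altSum (λ S → ∑ xs (f S)) ≡ ∑ xs (λ x → altSum (λ S → f S x))
  altSum-∑ xs f = begin
    altSum (λ S → ∑ xs (f S))                                   ≡⟨ altSum≡∑ _ ⟩
    ∑ (allSubsets k) (λ S → altSign S * ∑ xs (f S))             ≡⟨ ∑-cong (allSubsets k) (λ S → ∑-*ˡ xs (altSign S) (f S)) ⟨
    ∑ (allSubsets k) (λ S → ∑ xs (λ x → altSign S * f S x))     ≡⟨ ∑-comm (allSubsets k) xs _ ⟩
    ∑ xs (λ x → ∑ (allSubsets k) (λ S → altSign S * f S x))     ≡⟨ ∑-cong xs (λ x → altSum≡∑ (λ S → f S x)) ⟨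
    ∑ xs (λ x → altSum (λ S → f S x))                           ∎

module _ {k : ℕ} (f : Vec Bool (ℕ.suc k) → ℤ) where

  altSum-suc : altSum f ≡ signedSum (f ∘ (true Vec.∷_)) + altSum (f ∘ (false Vec.∷_))
  altSum-suc = trans (∑-pairs (true Vec.∷_) (false Vec.∷_) (allSubsets k) _) (∑-+ (allSubsets k) _ _)

  signedSum-suc : signedSum f ≡ signedSum (f ∘ (false Vec.∷_)) - signedSum (f ∘ (true Vec.∷_))
  signedSum-suc = begin
    signedSum f
      ≡⟨ ∑-pairs (true Vec.∷_) (false Vec.∷_) (allSubsets k) _ ⟩
    ∑ (allSubsets k) (λ S → - sgn (card S) * f (true Vec.∷ S) + sgn (card S) * f (false Vec.∷ S))
      ≡⟨ ∑-+ (allSubsets k) _ _ ⟩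
    ∑ (allSubsets k) (λ S → - sgn (card S) * f (true Vec.∷ S)) + signedSum (f ∘ (false Vec.∷_))
      ≡⟨ cong (_+ signedSum (f ∘ (false Vec.∷_))) negate-signedSum ⟩
    - signedSum (f ∘ (true Vec.∷_)) + signedSum (f ∘ (false Vec.∷_))
      ≡⟨ ℤ.+-comm (- signedSum (f ∘ (true Vec.∷_))) (signedSum (f ∘ (false Vec.∷_))) ⟩
    signedSum (f ∘ (false Vec.∷_)) - signedSum (f ∘ (true Vec.∷_))
      ∎
    where
    negate-signedSum : ∑ (allSubsets k) (λ S → - sgn (card S) * f (true Vec.∷ S))
                     ≡ - signedSum (f ∘ (true Vec.∷_))
    negate-signedSum =
      trans (∑-cong (allSubsets k) (λ S → sym (ℤ.neg-distribˡ-* (sgn (card S)) _)))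
            (∑-neg (allSubsets k) _)

altSum≡empty-signedSum : ∀ k (f : Vec Bool k → ℤ) → altSum f ≡ f (replicate k false) - signedSum f
altSum≡empty-signedSum ℕ.zero f = solve 1 (λ x → con (+ 0) := x :- (con (+ 1) :* x :+ con (+ 0))) refl (f Vec.[])
  where open +-*-Solver
altSum≡empty-signedSum (ℕ.suc k) f = begin
  altSum f                         ≡⟨ altSum-suc f ⟩
  T₁ + altSum (f ∘ (false Vec.∷_)) ≡⟨ cong (_+_ T₁) (altSum≡empty-signedSum k (f ∘ (false Vec.∷_))) ⟩
  T₁ + (f none - F₀)               ≡⟨ regroup T₁ (f none) F₀ ⟩
  f none - (F₀ - T₁)               ≡⟨ cong (_-_ (f none)) (signedSum-suc f) ⟨
  f none - signedSum f             ∎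
  where
  open +-*-Solver
  none : Vec Bool (ℕ.suc k)
  none = replicate (ℕ.suc k) false
  T₁ F₀ : ℤ
  T₁ = signedSum (f ∘ (true Vec.∷_))
  F₀ = signedSum (f ∘ (false Vec.∷_))
  regroup : ∀ t e z → t + (e - z) ≡ e - (z - t)
  regroup = solve 3 (λ t e z → t :+ (e :- z) := e :- (z :- t)) refl

-- Toggling coordinate i pairs the subsets with opposite signs.
signedSum-vanishes : ∀ {k} (i : Fin k) (f : Vec Bool k → ℤ) →
                     (∀ S → f (S [ i ]≔ true) ≡ f (S [ i ]≔ false)) → signedSum f ≡ + 0
signedSum-vanishes {ℕ.suc k} zero f toggle = begin
  signedSum f ≡⟨ signedSum-suc f ⟩
  F₀ - T₁     ≡⟨ cong (_-_ F₀) first-irrelevant ⟩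
  F₀ - F₀     ≡⟨ ℤ.+-inverseʳ F₀ ⟩
  + 0         ∎
  where
  T₁ F₀ : ℤ
  T₁ = signedSum (f ∘ (true Vec.∷_))
  F₀ = signedSum (f ∘ (false Vec.∷_))
  first-irrelevant : T₁ ≡ F₀
  first-irrelevant = ∑-cong (allSubsets k) (λ S → cong (sgn (card S) *_) (toggle (false Vec.∷ S)))
signedSum-vanishes {ℕ.suc k} (suc i) f toggle = begin
  signedSum f                                                    ≡⟨ signedSum-suc f ⟩
  signedSum (f ∘ (false Vec.∷_)) - signedSum (f ∘ (true Vec.∷_)) ≡⟨ cong₂ _-_ (vanishes false) (vanishes true) ⟩
  + 0                                                            ∎
  where
  vanishes : ∀ b → signedSum (f ∘ (b Vec.∷_)) ≡ + 0
  vanishes b = signedSum-vanishes i (f ∘ (b Vec.∷_)) (λ S → toggle (b Vec.∷ S))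

T-injective : ∀ {x y} → T x ⇔ T y → x ≡ y
T-injective Tx⇔Ty = ⇔→≡ (⇔.trans (⇔.sym T-≡) (⇔.trans Tx⇔Ty T-≡))

T-not-∨ : ∀ {x y} → T (not x ∨ y) ⇔ (T x → T y)
T-not-∨ {false} = mk⇔ (λ _ ()) _
T-not-∨ {true}  = mk⇔ (λ Ty _ → Ty) (λ Tx→Ty → Tx→Ty _)

T-not-≡ᵇ : ∀ m n → T (not (m ≡ᵇ n)) ⇔ (m ≢ n)
T-not-≡ᵇ m n with m ≡ᵇ n in eq
... | true  = mk⇔ (λ ()) (λ m≢n → m≢n (ℕ.≡ᵇ⇒≡ m n (from T-≡ eq)))
... | false = mk⇔ (λ _ m≡n → subst T eq (ℕ.≡⇒≡ᵇ m n m≡n)) _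

T-all-allFin : ∀ {n} {p : Fin n → Bool} → T (all p (allFin n)) ⇔ (∀ i → T (p i))
T-all-allFin {n} {p} = mk⇔ (All.tabulate⁻ ∘ All.all⁺ p (allFin n)) (All.all⁻ p ∘ All.tabulate⁺)

T-any-allFin : ∀ {n} {p : Fin n → Bool} → T (any p (allFin n)) ⇔ (∃[ i ] T (p i))
T-any-allFin {n} {p} =
  mk⇔ (Any.tabulate⁻ ∘ Any.any⁻ p (allFin n)) (λ (i , pᵢ) → Any.any⁺ p (Any.tabulate⁺ i pᵢ))

T-== : ∀ {n} {a b : Fin n} → T (a == b) ⇔ (a ≡ b)
T-== {a = a} {b} = mk⇔ (toWitness {a? = a Fin.≟ b}) (fromWitness {a? = a Fin.≟ b})

ind : Bool → ℤ
ind b = if b then + 1 else + 0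

ind-∧ : ∀ a b → ind (a ∧ b) ≡ ind a * ind b
ind-∧ true  b = sym (ℤ.*-identityˡ (ind b))
ind-∧ false b = refl

+-if≡ind : ∀ b → + (if b then 1 else 0) ≡ ind b
+-if≡ind true  = refl
+-if≡ind false = refl

ind*≡ind : ∀ b {a} → (T b → a ≡ + 1) → ind b * a ≡ ind b
ind*≡ind true  {a} a≡1 = trans (ℤ.*-identityˡ a) (a≡1 _)
ind*≡ind false     _   = refl

avoids : ∀ {k} → Vec Bool k → (Fin k → Bool) → Bool
avoids Vec.[]      d = true
avoids (s Vec.∷ S) d = (not s ∨ not (d zero)) ∧ avoids S (d ∘ suc)

avoids-empty : ∀ k (d : Fin k → Bool) → avoids (replicate k false) d ≡ true
avoids-empty ℕ.zero    d = refl
avoids-empty (ℕ.suc k) d = avoids-empty k (d ∘ suc)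

T-avoids : ∀ {k} (S : Vec Bool k) (d : Fin k → Bool) →
           T (avoids S d) ⇔ (∀ i → T (lookup S i) → T (not (d i)))
T-avoids Vec.[]      d = mk⇔ (λ _ ()) _
T-avoids (s Vec.∷ S) d = mk⇔
  (λ avoiding → let (head , tail) = to (T-∧ {not s ∨ not (d zero)}) avoiding in
     λ { zero → to T-not-∨ head ; (suc i) → to (T-avoids S (d ∘ suc)) tail i })
  (λ h → from (T-∧ {not s ∨ not (d zero)}) (from T-not-∨ (h zero) , from (T-avoids S (d ∘ suc)) (h ∘ suc)))

avoids-toggle : ∀ {k} (d : Fin k → Bool) (i : Fin k) → T (not (d i)) →
                ∀ S → avoids (S [ i ]≔ true) d ≡ avoids (S [ i ]≔ false) d
avoids-toggle d zero    ¬dᵢ (s Vec.∷ S) rewrite to T-not-≡ ¬dᵢ = refl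
avoids-toggle d (suc i) ¬dᵢ (s Vec.∷ S) = cong (_ ∧_) (avoids-toggle (d ∘ suc) i ¬dᵢ S)

altSum-avoids : ∀ {k} (d : Fin k → Bool) (i : Fin k) → T (not (d i)) →
                altSum (λ S → ind (avoids S d)) ≡ + 1
altSum-avoids {k} d i ¬dᵢ = begin
  altSum (λ S → ind (avoids S d))
    ≡⟨ altSum≡empty-signedSum k _ ⟩
  ind (avoids (replicate k false) d) - signedSum (λ S → ind (avoids S d))
    ≡⟨ cong₂ (λ e s → ind e - s) (avoids-empty k d)
             (signedSum-vanishes i _ (λ S → cong ind (avoids-toggle d i ¬dᵢ S))) ⟩
  + 1
    ∎

module _ {n : ℕ} where

  Proper : Graph n → (Fin n → ℕ) → Set
  Proper G c = ∀ a b → T (G a b) → c a ≢ c b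

  T-isProper : ∀ {G : Graph n} {c} → T (isProper G c) ⇔ Proper G c
  T-isProper = mk⇔
    (λ p a b Gab → to (T-not-≡ᵇ _ _) (to T-not-∨ (to T-all-allFin (to T-all-allFin p a) b) Gab))
    (λ h → from T-all-allFin (λ a → from T-all-allFin (λ b →
             from T-not-∨ (λ Gab → from (T-not-≡ᵇ _ _) (h a b Gab)))))

module _ {n k : ℕ} (G : Graph n) (u : Fin k → Fin n) (v : Fin n) (S : Vec Bool k) where

  added : Fin n → Fin n → Fin k → Bool
  added a b i = lookup S i ∧ ((a == u i ∧ b == v) ∨ (a == v ∧ b == u i))

  old-edge : ∀ {a b} → T (G a b) → T (addEdges G u v S a b)
  old-edge {a} {b} Gab = from (T-∨ {G a b}) (inj₁ Gab)

  new-edge : ∀ i → T (lookup S i) → T (addEdges G u v S (u i) v)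
  new-edge i i∈S = from (T-∨ {G (u i) v}) (inj₂ (from (T-any-allFin {p = added (u i) v}) (i , i-added)))
    where
    i-added : T (added (u i) v i)
    i-added = from (T-∧ {lookup S i}) (i∈S , from (T-∨ {u i == u i ∧ v == v})
                (inj₁ (from (T-∧ {u i == u i}) (from T-== refl , from T-== refl))))

  addEdges-edge : ∀ {a b} → T (addEdges G u v S a b) →
    T (G a b) ⊎ ∃[ i ] T (lookup S i) × ((a ≡ u i × b ≡ v) ⊎ (a ≡ v × b ≡ u i))
  addEdges-edge e with to T-∨ e
  ... | inj₁ Gab = inj₁ Gab
  ... | inj₂ new with to T-any-allFin new
  ...   | i , hit with to T-∧ hit
  ...     | i∈S , ends with to T-∨ ends
  ...       | inj₁ forward  = inj₂ (i , i∈S , inj₁ (Product.map (to T-==) (to T-==) (to T-∧ forward)))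
  ...       | inj₂ backward = inj₂ (i , i∈S , inj₂ (Product.map (to T-==) (to T-==) (to T-∧ backward)))

module _ {n k : ℕ} (G : Graph n) (u : Fin k → Fin n) (v : Fin n) where

  monochromatic : (Fin n → ℕ) → Fin k → Bool
  monochromatic c i = c (u i) ≡ᵇ c v

  Proper-addEdges : ∀ S c →
    Proper (addEdges G u v S) c ⇔ (Proper G c × (∀ i → T (lookup S i) → c (u i) ≢ c v))
  Proper-addEdges S c = mk⇔
    (λ proper → (λ a b Gab → proper a b (old-edge G u v S Gab))
              , (λ i i∈S → proper (u i) v (new-edge G u v S i i∈S)))
    (λ (proper , separated) a b e → edge-separated proper separated (addEdges-edge G u v S e))
    where
    edge-separated : ∀ {a b} → Proper G c → (∀ i → T (lookup S i) → c (u i) ≢ c v) →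
      T (G a b) ⊎ ∃[ i ] T (lookup S i) × ((a ≡ u i × b ≡ v) ⊎ (a ≡ v × b ≡ u i)) → c a ≢ c b
    edge-separated proper separated (inj₁ Gab)                            = proper _ _ Gab
    edge-separated proper separated (inj₂ (i , i∈S , inj₁ (refl , refl))) = separated i i∈S
    edge-separated proper separated (inj₂ (i , i∈S , inj₂ (refl , refl))) = separated i i∈S ∘ sym

  isProper-addEdges : ∀ S c →
    isProper (addEdges G u v S) c ≡ isProper G c ∧ avoids S (monochromatic c)
  isProper-addEdges S c = T-injective (mk⇔
    (λ proper → let (properG , separated) = to (Proper-addEdges S c) (to T-isProper proper) in
      from (T-∧ {isProper G c}) (from T-isProper properG ,
        from (T-avoids S (monochromatic c)) (λ i i∈S → from (T-not-≡ᵇ _ _) (separated i i∈S))))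
    (λ both → let (properG , avoiding) = to (T-∧ {isProper G c}) both in
      from T-isProper (from (Proper-addEdges S c) (to T-isProper properG ,
        λ i i∈S → to (T-not-≡ᵇ _ _) (to (T-avoids S (monochromatic c)) avoiding i i∈S)))))

  Y-addEdges : ∀ S c → Y (addEdges G u v S) c ≡ Y G c * ind (avoids S (monochromatic c))
  Y-addEdges S c = trans (cong ind (isProper-addEdges S c)) (ind-∧ (isProper G c) _)

  Y-expansion : ∀ c → (T (isProper G c) → ∃[ i ] c (u i) ≢ c v) →
                Y G c ≡ altSum (λ S → Y (addEdges G u v S) c)
  Y-expansion c separated = sym (begin
    altSum (λ S → Y (addEdges G u v S) c)                   ≡⟨ altSum-cong (λ S → Y-addEdges S c) ⟩
    altSum (λ S → Y G c * ind (avoids S (monochromatic c))) ≡⟨ altSum-*ˡ (Y G c) (λ S → ind (avoids S (monochromatic c))) ⟩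
    Y G c * altSum (λ S → ind (avoids S (monochromatic c))) ≡⟨ ind*≡ind (isProper G c) inclusion-exclusion ⟩
    Y G c                                                   ∎)
    where
    inclusion-exclusion : T (isProper G c) → altSum (λ S → ind (avoids S (monochromatic c))) ≡ + 1
    inclusion-exclusion proper =
      let (i , cᵢ≢cv) = separated proper in altSum-avoids (monochromatic c) i (from (T-not-≡ᵇ _ _) cᵢ≢cv)

module _ {n : ℕ} where

  X≡∑Y : ∀ (G : Graph n) w → X G w ≡ ∑ (allFuns n (ℕ.suc (maxCol w)))
                           (λ f → ind (sameContent w (toℕ ∘ f)) * Y G (toℕ ∘ f))
  X≡∑Y G w = trans (+sum≡∑ (allFuns n (ℕ.suc (maxCol w))) _)
                 (∑-cong (allFuns n (ℕ.suc (maxCol w)))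
                         (λ f → trans (+-if≡ind _) (ind-∧ (sameContent w (toℕ ∘ f)) _)))

  X-expansion : ∀ {k} (G : Graph n) (H : Vec Bool k → Graph n) →
                (∀ c → Y G c ≡ altSum (λ S → Y (H S) c)) →
                ∀ w → X G w ≡ altSum (λ S → X (H S) w)
  X-expansion G H Y-identity w = begin
    X G w
      ≡⟨ X≡∑Y G w ⟩
    ∑ colourings (λ f → content f * Y G (toℕ ∘ f))
      ≡⟨ ∑-cong colourings (λ f → cong (_*_ (content f)) (Y-identity (toℕ ∘ f))) ⟩
    ∑ colourings (λ f → content f * altSum (λ S → Y (H S) (toℕ ∘ f)))
      ≡⟨ ∑-cong colourings (λ f → altSum-*ˡ (content f) (λ S → Y (H S) (toℕ ∘ f))) ⟨
    ∑ colourings (λ f → altSum (λ S → content f * Y (H S) (toℕ ∘ f)))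
      ≡⟨ altSum-∑ colourings (λ S f → content f * Y (H S) (toℕ ∘ f)) ⟨
    altSum (λ S → ∑ colourings (λ f → content f * Y (H S) (toℕ ∘ f)))
      ≡⟨ altSum-cong (λ S → X≡∑Y (H S) w) ⟨
    altSum (λ S → X (H S) w)
      ∎
    where
    colourings : List (Fin n → Fin (ℕ.suc (maxCol w)))
    colourings = allFuns n (ℕ.suc (maxCol w))
    content : (Fin n → Fin (ℕ.suc (maxCol w))) → ℤ
    content f = ind (sameContent w (toℕ ∘ f))

module _ {n : ℕ} {_≼_ : Fin n → Fin n → Set} where

  lower-covers-incomparable : ∀ {a b v} → Covers _≼_ a v → Covers _≼_ b v → a ≢ b → ¬ a ≼ b
  lower-covers-incomparable (_ , _ , between) (b≼v , b≢v , _) a≢b a≼b with between _ a≼b b≼v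
  ... | inj₁ b≡a = a≢b (sym b≡a)
  ... | inj₂ b≡v = b≢v b≡v

  upper-covers-incomparable : ∀ {a b v} → Covers _≼_ v a → Covers _≼_ v b → a ≢ b → ¬ a ≼ b
  upper-covers-incomparable (v≼a , v≢a , _) (_ , _ , between) a≢b a≼b with between _ v≼a a≼b
  ... | inj₁ a≡v = v≢a (sym a≡v)
  ... | inj₂ a≡b = a≢b a≡b

  module _ (po : IsDecPartialOrder _≡_ _≼_) where
    open IsDecPartialOrder po using (_≤?_)

    incomparable⇒inc : ∀ {a b} → ¬ a ≼ b → ¬ b ≼ a → T (inc po a b)
    incomparable⇒inc {a} {b} a⋠b b⋠a =
      from (T-∧ {not ⌊ a ≤? b ⌋}) (fromWitnessFalse {a? = a ≤? b} a⋠b , fromWitnessFalse {a? = b ≤? a} b⋠a)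

    siblings-inc : ∀ {k} {u : Fin k → Fin n} {v} →
      (∀ i → Covers _≼_ (u i) v) ⊎ (∀ i → Covers _≼_ v (u i)) →
      ∀ {i j} → u i ≢ u j → T (inc po (u i) (u j))
    siblings-inc (inj₁ lower) {i} {j} uᵢ≢uⱼ = incomparable⇒inc
      (lower-covers-incomparable (lower i) (lower j) uᵢ≢uⱼ)
      (lower-covers-incomparable (lower j) (lower i) (uᵢ≢uⱼ ∘ sym))
    siblings-inc (inj₂ upper) {i} {j} uᵢ≢uⱼ = incomparable⇒inc
      (upper-covers-incomparable (upper i) (upper j) uᵢ≢uⱼ)
      (upper-covers-incomparable (upper j) (upper i) (uᵢ≢uⱼ ∘ sym))

    proper-separates-some-sibling : ∀ {k} {u : Fin k → Fin n} {v} → 2 ≤ k → Injective _≡_ _≡_ u →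
      (∀ i → Covers _≼_ (u i) v) ⊎ (∀ i → Covers _≼_ v (u i)) →
      ∀ c → T (isProper (inc po) c) → ∃[ i ] c (u i) ≢ c v
    proper-separates-some-sibling {u = u} {v} (s≤s (s≤s z≤n)) u-injective covers c proper
      with c (u zero) ℕ.≟ c v
    ... | no  c₀≢cv = zero , c₀≢cv
    ... | yes c₀≡cv = suc zero , λ c₁≡cv → c₀≢c₁ (trans c₀≡cv (sym c₁≡cv))
      where
      c₀≢c₁ : c (u zero) ≢ c (u (suc zero))
      c₀≢c₁ = to (T-isProper {G = inc po} {c}) proper _ _ (siblings-inc covers (0≢1+n ∘ u-injective))

mainTheorem18 : ∀ {n k : ℕ} (_≼_ : Fin n → Fin n → Set) (po : IsDecPartialOrder _≡_ _≼_)
    (v : Fin n) (u : Fin k → Fin n) → 2 ≤ k → Injective _≡_ _≡_ u →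
    ((∀ i → Covers _≼_ (u i) v) ⊎ (∀ i → Covers _≼_ v (u i))) →
    (∀ (c : Fin n → ℕ) → Y (inc po) c ≡ altSum (λ S → Y (addEdges (inc po) u v S) c))
    × (∀ (w : Fin n → ℕ) → X (inc po) w ≡ altSum (λ S → X (addEdges (inc po) u v S) w))
mainTheorem18 _≼_ po v u 2≤k u-injective covers =
  Y-identity , X-expansion (inc po) (addEdges (inc po) u v) Y-identity
  where
  Y-identity : ∀ c → Y (inc po) c ≡ altSum (λ S → Y (addEdges (inc po) u v S) c)
  Y-identity c = Y-expansion (inc po) u v c
    (proper-separates-some-sibling po 2≤k u-injective covers c)
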